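{- In a strong labeling of a quadrangulation, for each edge the incident labels coincide at one endpoint and differ at the other; moreover, orienting the edge towards the endpoint where the labels coincide, if the endpoint where the labels differ is white (respectively black), then the two labels on the right (respectively left) side of the edge coincide.
   Context: A quadrangulation is a plane graph that is a maximal bipartite plane graph; all faces, including the outer one, are bounded by 4-cycles. Its vertices are properly colored black and white. An angle is a corner of a face at a vertex; each edge has four incident angles: at each endpoint, one on each side of the edge (so each side of an edge carries one label at each endpoint). A strong labeling of $Q$ is a map from angles to $\{0,1\}$ with: (G0) the two black outer vertices are named $s_0,s_1$ and all angles at $s_i$ are labeled $i$; (G1) for each $v\notin\{s_0,s_1\}$ the labels around $v$ form a non-empty interval of 1s and a non-empty interval of 0s; (G2) for each edge, the incident labels coincide at one endpoint and differ at the other; (G3$^+_Q$) labels in each bounded face are $0011$ cyclically, and labels of the outer face read clockwise from $s_0$ are $0011$. -}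

module Defs where

open import Data.Nat using (ℕ; zero; suc; _+_; _<_; _<ᵇ_)
open import Data.Fin using (Fin)
open import Data.Fin.Permutation using (Permutation′; _⟨$⟩ʳ_; _⟨$⟩ˡ_)
open import Data.Bool using (Bool; true; false)
open import Data.Product using (Σ; ∃; _×_; _,_)
open import Data.Sum using (_⊎_)
open import Relation.Binary.PropositionalEquality using (_≡_; _≢_)
open import Relation.Nullary using (¬_)

-- Darts (half-edges) are Fin n.  σ is the counterclockwise rotation of
-- darts around their origin vertex; α is the edge involution (α d is the
-- reverse of d).  Vertices = σ-orbits, edges = α-orbits, faces = φ-orbits
-- with φ = σ⁻¹ ∘ α (traverses a face keeping it on the LEFT; bounded faces
-- are thus traversed counterclockwise and the outer face clockwise).
-- The angle ("corner") associated with dart d is the corner at the origin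
-- of d between d and σ d (counterclockwise); it is the corner on the LEFT
-- side of d at its origin, and it lies in the face φ-orbit of d.

iter : ∀ {A : Set} → (A → A) → ℕ → A → A
iter f zero    x = x
iter f (suc k) x = f (iter f k x)

InOrbit : ∀ {A : Set} → (A → A) → A → A → Set
InOrbit f x y = ∃ λ k → iter f k x ≡ y

NumOrbits : ∀ {n} → (Fin n → Fin n) → ℕ → Set
NumOrbits {n} f k =
  Σ (Fin k → Fin n) λ rep →
    ((i j : Fin k) → InOrbit f (rep i) (rep j) → i ≡ j) ×
    ((d : Fin n) → ∃ λ i → InOrbit f (rep i) d)

data Conn {n : ℕ} (σ α : Fin n → Fin n) (d : Fin n) : Fin n → Set where
  here  : Conn σ α d d
  stepσ : ∀ {e} → Conn σ α d e → Conn σ α d (σ e)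
  stepα : ∀ {e} → Conn σ α d e → Conn σ α d (α e)

data Color : Set where
  black white : Color

record Quadrangulation (n : ℕ) : Set where
  field
    σ      : Permutation′ n
    α      : Fin n → Fin n
  σʳ : Fin n → Fin n
  σʳ d = σ ⟨$⟩ʳ d
  σˡ : Fin n → Fin n
  σˡ d = σ ⟨$⟩ˡ d
  φ : Fin n → Fin n
  φ d = σˡ (α d)
  SameVertex : Fin n → Fin n → Set
  SameVertex = InOrbit σʳ
  field
    α-invol    : ∀ d → α (α d) ≡ d
    α-fixfree  : ∀ d → α d ≢ d
    connected  : ∀ d e → Conn σʳ α d e
    -- plane: connected map with Euler characteristic 2 (genus 0)
    euler      : ∃ λ V → ∃ λ E → ∃ λ F →
                   NumOrbits σʳ V × NumOrbits α E × NumOrbits φ F ×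
                   V + F ≡ E + 2
    -- simple graph: no multiple edges (no loops follows from bipartiteness)
    simple     : ∀ d e → SameVertex d e → SameVertex (α d) (α e) → d ≡ e
    face-4     : ∀ d → iter φ 4 d ≡ d
    face-cycle : ∀ d i j → i < j → j < 4 →
                   ¬ SameVertex (iter φ i d) (iter φ j d)
    col        : Fin n → Color
    col-σ      : ∀ d → col (σʳ d) ≡ col d
    col-α      : ∀ d → col (α d) ≢ col d
    outer      : Fin n
  OnOuter : Fin n → Set
  OnOuter = InOrbit φ outer

data Cyc0011 : Bool → Bool → Bool → Bool → Set where
  c0 : Cyc0011 false false true true
  c1 : Cyc0011 false true true false
  c2 : Cyc0011 true true false false
  c3 : Cyc0011 true false false true

Xor : Set → Set → Set
Xor P Q = (P × ¬ Q) ⊎ (¬ P × Q)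

module _ {n : ℕ} (Q : Quadrangulation n) where
  open Quadrangulation Q

  -- label of the corner on the LEFT / RIGHT side of d at its origin (tail)
  -- and at its head.
  module Sides (lab : Fin n → Bool) where
    leftTail : Fin n → Bool
    leftTail d = lab d
    rightTail : Fin n → Bool
    rightTail d = lab (σˡ d)
    rightHead : Fin n → Bool
    rightHead d = lab (α d)
    leftHead : Fin n → Bool
    leftHead d = lab (σˡ (α d))
    CoincideTail : Fin n → Set
    CoincideTail d = leftTail d ≡ rightTail d
    CoincideHead : Fin n → Set
    CoincideHead d = leftHead d ≡ rightHead d

  -- (G1) around the vertex of d: a non-empty interval of 1s followed by a
  -- non-empty interval of 0s (m = degree of the vertex).
  TwoIntervals : (Fin n → Bool) → Fin n → Set
  TwoIntervals lab d0 =
    ∃ λ d → SameVertex d0 d ×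
    ∃ λ m → ∃ λ k → 0 < k × k < m ×
      iter σʳ m d ≡ d × (∀ j → 0 < j → j < m → iter σʳ j d ≢ d) ×
      (∀ i → i < m → lab (iter σʳ i d) ≡ (i <ᵇ k))

  -- labels: false = 0, true = 1; lab d is the label of the corner of d.
  record StrongLabeling : Set where
    field
      lab   : Fin n → Bool
      o     : Fin n
      o-outer : OnOuter o
      o-black : col o ≡ black
    open Sides lab
    -- s₀ = origin of o, s₁ = origin of φ (φ o) (the other black outer vertex)
    field
      G0-s0 : ∀ d → SameVertex o d → lab d ≡ false
      G0-s1 : ∀ d → SameVertex (φ (φ o)) d → lab d ≡ true
      G1    : ∀ d → ¬ SameVertex o d → ¬ SameVertex (φ (φ o)) d →
                TwoIntervals lab d
      G2    : ∀ d → Xor (CoincideTail d) (CoincideHead d)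
      G3-bounded : ∀ d → ¬ OnOuter d →
                Cyc0011 (lab d) (lab (φ d)) (lab (φ (φ d))) (lab (φ (φ (φ d))))
      -- outer face read clockwise (= along φ) from s₀ : 0011
      G3-outer : lab o ≡ false × lab (φ o) ≡ false ×
                 lab (φ (φ o)) ≡ true × lab (φ (φ (φ o))) ≡ true

-- For a dart d, the two corners on the left side of d (at its tail and at its
-- head) carry equal labels exactly when the tail of d is black.  This holds on
-- the outer face by (G3).  In a bounded face the pattern 0011 makes agreement
-- and disagreement alternate between consecutive corners, as do the colours,
-- so the invariant travels along faces; (G2) carries it from a dart to its
-- reverse, whose left side is the right side of the dart.  Since σ = α ∘ φ³,
-- connectivity spreads it to every dart, and both conclusions are instances.
module Submission where

open import Defs
open import Data.Nat using (ℕ; zero; suc; _+_)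
open import Data.Fin using (Fin)
open import Data.Fin.Permutation using (inverseʳ)
open import Data.Bool using (Bool; true; false; not; _xor_; _≟_)
open import Data.Bool.Properties
  using (¬-not; xor-comm; not-distribˡ-xor; not-distribʳ-xor)
open import Data.Product using (_×_; _,_)
open import Data.Sum using (inj₁; inj₂)
open import Function using (_∘_)
open import Relation.Binary.PropositionalEquality
open import Relation.Nullary using (¬_; yes; no; contradiction)
open import Relation.Nullary.Decidable using (decidable-stable; ¬¬-excluded-middle)

xor≡false⇒≡ : ∀ {x y} → x xor y ≡ false → x ≡ y
xor≡false⇒≡ {false} {false} _ = refl
xor≡false⇒≡ {false} {true}  ()
xor≡false⇒≡ {true}  {false} ()
xor≡false⇒≡ {true}  {true}  _ = refl

Xor-≡⇒xor≡not-xor : ∀ {x x′ y y′ : Bool} → Xor (x ≡ x′) (y ≡ y′) →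
                    y′ xor x′ ≡ not (x xor y)
Xor-≡⇒xor≡not-xor {x} {y = y} (inj₁ (refl , y≢y′))
  rewrite ¬-not (≢-sym y≢y′) = trans (xor-comm (not y) x) (sym (not-distribʳ-xor x y))
Xor-≡⇒xor≡not-xor {x} {y = y} (inj₂ (x≢x′ , refl))
  rewrite ¬-not (≢-sym x≢x′) = trans (xor-comm y (not x)) (sym (not-distribˡ-xor x y))

Cyc0011⇒xor-alternates : ∀ {a b c d} → Cyc0011 a b c d → b xor c ≡ not (a xor b)
Cyc0011⇒xor-alternates c0 = refl
Cyc0011⇒xor-alternates c1 = refl
Cyc0011⇒xor-alternates c2 = refl
Cyc0011⇒xor-alternates c3 = refl

isWhite : Color → Bool
isWhite black = false
isWhite white = true

isWhite-≢ : ∀ {c c′} → c ≢ c′ → isWhite c ≡ not (isWhite c′)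
isWhite-≢ {black} {black} c≢c′ = contradiction refl c≢c′
isWhite-≢ {black} {white} _    = refl
isWhite-≢ {white} {black} _    = refl
isWhite-≢ {white} {white} c≢c′ = contradiction refl c≢c′

module _ {A : Set} (f : A → A) where

  iter-+ : ∀ m n x → iter f (m + n) x ≡ iter f m (iter f n x)
  iter-+ zero    n x = refl
  iter-+ (suc m) n x = cong f (iter-+ m n x)

  iter-suc-inner : ∀ m x → iter f m (f x) ≡ iter f (suc m) x
  iter-suc-inner zero    x = refl
  iter-suc-inner (suc m) x = cong f (iter-suc-inner m x)

  InOrbit-trans : ∀ {x y z} → InOrbit f x y → InOrbit f y z → InOrbit f x z
  InOrbit-trans {x} (k , refl) (l , refl) = l + k , iter-+ l k x

  InOrbit-sym : ∀ {m} → (∀ x → iter f (suc m) x ≡ x) →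
                ∀ {x y} → InOrbit f x y → InOrbit f y x
  InOrbit-sym period (zero  , x≡y)  = zero , sym x≡y
  InOrbit-sym {m} period {x} (suc k , refl) =
    InOrbit-trans (m , trans (iter-suc-inner m w) (period w)) (InOrbit-sym {m} period (k , refl))
    where w = iter f k x

module Properties {n : ℕ} (Q : Quadrangulation n) where
  open Quadrangulation Q

  col-σˡ : ∀ d → col (σˡ d) ≡ col d
  col-σˡ d = trans (sym (col-σ (σˡ d))) (cong col (inverseʳ σ))

  isWhite-col-α : ∀ d → isWhite (col (α d)) ≡ not (isWhite (col d))
  isWhite-col-α d = isWhite-≢ (col-α d)

  isWhite-col-φ : ∀ d → isWhite (col (φ d)) ≡ not (isWhite (col d))
  isWhite-col-φ d = trans (cong isWhite (col-σˡ (α d))) (isWhite-col-α d)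

  φ∘α≡σˡ : ∀ d → φ (α d) ≡ σˡ d
  φ∘α≡σˡ d = cong σˡ (α-invol d)

  α∘φ³≡σʳ : ∀ d → α (φ (φ (φ d))) ≡ σʳ d
  α∘φ³≡σʳ d = trans (sym (inverseʳ σ)) (cong σʳ (face-4 d))

  φ-orbit-sym : ∀ {d e} → InOrbit φ d e → InOrbit φ e d
  φ-orbit-sym = InOrbit-sym φ {3} face-4

  φα-closed⇒universal : (P : Fin n → Set) →
    (∀ {d} → P d → P (φ d)) → (∀ {d} → P d → P (α d)) →
    ∀ {d} → P d → ∀ e → P e
  φα-closed⇒universal P φ-step α-step {d} Pd e = reach (connected d e)
    where
      reach : ∀ {e} → Conn σʳ α d e → P e
      reach here      = Pd
      reach (stepσ c) = subst P (α∘φ³≡σʳ _) (α-step (φ-step (φ-step (φ-step (reach c)))))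
      reach (stepα c) = α-step (reach c)

  module Labeled (L : StrongLabeling Q) where
    open StrongLabeling L
    open Sides Q lab

    LeftSideLaw : Fin n → Set
    LeftSideLaw d = leftTail d xor leftHead d ≡ isWhite (col d)

    leftSideLaw-outer : ∀ k → LeftSideLaw (iter φ k o)
    leftSideLaw-outer 0 with G3-outer
    ... | l₀ , l₁ , _ rewrite l₀ | l₁ | o-black = refl
    leftSideLaw-outer 1 with G3-outer
    ... | _ , l₁ , l₂ , _ rewrite l₁ | l₂ | isWhite-col-φ o | o-black = refl
    leftSideLaw-outer 2 with G3-outer
    ... | _ , _ , l₂ , l₃
      rewrite l₂ | l₃ | isWhite-col-φ (φ o) | isWhite-col-φ o | o-black = refl
    leftSideLaw-outer 3 with G3-outer
    ... | l₀ , _ , _ , l₃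
      rewrite l₃ | face-4 o | l₀
            | isWhite-col-φ (φ (φ o)) | isWhite-col-φ (φ o) | isWhite-col-φ o | o-black = refl
    leftSideLaw-outer (suc (suc (suc (suc k)))) =
      subst LeftSideLaw (sym (face-4 (iter φ k o))) (leftSideLaw-outer k)

    leftSideLaw-onOuter : ∀ {d} → OnOuter d → LeftSideLaw d
    leftSideLaw-onOuter d-outer with InOrbit-trans φ (φ-orbit-sym o-outer) d-outer
    ... | k , refl = leftSideLaw-outer k

    leftSideLaw-bounded : ∀ {d} → ¬ OnOuter d → LeftSideLaw d → LeftSideLaw (φ d)
    leftSideLaw-bounded {d} d-inner law = begin
      lab (φ d) xor lab (φ (φ d)) ≡⟨ Cyc0011⇒xor-alternates (G3-bounded d d-inner) ⟩
      not (lab d xor lab (φ d))   ≡⟨ cong not law ⟩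
      not (isWhite (col d))       ≡⟨ sym (isWhite-col-φ d) ⟩
      isWhite (col (φ d))         ∎
      where open ≡-Reasoning

    -- The goal is a Boolean equation, hence stable under double negation, so we
    -- may case on whether d lies on the outer face.
    leftSideLaw-φ : ∀ {d} → LeftSideLaw d → LeftSideLaw (φ d)
    leftSideLaw-φ {d} law = decidable-stable (_ ≟ _) λ ¬law → ¬¬-excluded-middle {A = OnOuter d} λ where
      (yes (k , d-outer)) → ¬law (leftSideLaw-onOuter (suc k , cong φ d-outer))
      (no d-inner)        → ¬law (leftSideLaw-bounded d-inner law)

    leftSideLaw-α : ∀ {d} → LeftSideLaw d → LeftSideLaw (α d)
    leftSideLaw-α {d} law = begin
      lab (α d) xor lab (φ (α d)) ≡⟨ cong (λ e → lab (α d) xor lab e) (φ∘α≡σˡ d) ⟩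
      lab (α d) xor lab (σˡ d)    ≡⟨ Xor-≡⇒xor≡not-xor (G2 d) ⟩
      not (lab d xor lab (φ d))   ≡⟨ cong not law ⟩
      not (isWhite (col d))       ≡⟨ sym (isWhite-col-α d) ⟩
      isWhite (col (α d))         ∎
      where open ≡-Reasoning

    leftSideLaw : ∀ d → LeftSideLaw d
    leftSideLaw = φα-closed⇒universal LeftSideLaw leftSideLaw-φ leftSideLaw-α {o}
                    (leftSideLaw-outer 0)

    leftSide-agree : ∀ d → isWhite (col d) ≡ false → leftTail d ≡ leftHead d
    leftSide-agree d d-black = xor≡false⇒≡ (trans (leftSideLaw d) d-black)

    leftSide-black : ∀ d → col d ≡ black → leftTail d ≡ leftHead d
    leftSide-black d d-black = leftSide-agree d (cong isWhite d-black)

    rightSide-white : ∀ d → col d ≡ white → rightTail d ≡ rightHead d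
    rightSide-white d d-white = begin
      lab (σˡ d)     ≡⟨ cong lab (φ∘α≡σˡ d) ⟨
      lab (φ (α d))  ≡⟨ leftSide-agree (α d) αd-black ⟨
      lab (α d)      ∎
      where
        open ≡-Reasoning
        αd-black : isWhite (col (α d)) ≡ false
        αd-black = trans (isWhite-col-α d) (cong (not ∘ isWhite) d-white)

lemma2 : ∀ {n} (Q : Quadrangulation n) (L : StrongLabeling Q) →
    let open Quadrangulation Q
        open StrongLabeling L
        open Sides Q lab
    in (∀ d → Xor (CoincideTail d) (CoincideHead d)) ×
       (∀ d → CoincideHead d → ¬ CoincideTail d →
          (col d ≡ white → rightTail d ≡ rightHead d) ×
          (col d ≡ black → leftTail d ≡ leftHead d))
lemma2 Q L = G2 , λ d _ _ → rightSide-white d , leftSide-black d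
  where
    open StrongLabeling L using (G2)
    open Properties.Labeled Q L
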